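{- For all integers $k\ge1$ and $n\ge0$, $a_k(\lfloor 2n/k\rfloor)\le A_k(n)\le a_k(n)$.
   Context: A P-position of the game of Nim with $k$ piles is a $k$-tuple $(p_1,\dots,p_k)$ of non-negative integers whose nim-sum $p_1\oplus\cdots\oplus p_k$ is $0$, where $\oplus$ denotes bitwise XOR. $a_k(m)$ is the number of P-positions with $k$ piles in which every pile has at most $m$ counters; $A_k(n)$ is the number of P-positions with $k$ piles whose total number of counters is at most $2n$. -}

module Defs where

open import Data.Nat using (ℕ; zero; suc; _+_; _*_; _≤_; _≤?_; _≟_)
open import Data.Nat.DivMod using (_/_; _%_)
open import Data.Bool using (Bool; true; false; _xor_; if_then_else_)
open import Data.List using (List; []; _∷_; concatMap; filter; length; upTo; map)
open import Data.Vec using (Vec; []; _∷_; foldr)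
open import Relation.Nullary.Decidable using (_×-dec_; does)
import Data.Nat

-- Bitwise XOR on ℕ, defined with a fuel argument (fuel a + b suffices,
-- since each step halves both arguments).
xorFuel : ℕ → ℕ → ℕ → ℕ
xorFuel zero    a b = 0
xorFuel (suc f) a b =
  (if odd a xor odd b then 1 else 0) + 2 * xorFuel f (a / 2) (b / 2)
  where
  odd : ℕ → Bool
  odd x = does (x % 2 ≟ 1)

_⊕_ : ℕ → ℕ → ℕ
a ⊕ b = xorFuel (a + b) a b

nimSum : ∀ {k} → Vec ℕ k → ℕ
nimSum = foldr _ _⊕_ 0

total : ∀ {k} → Vec ℕ k → ℕ
total = foldr _ _+_ 0

tuples : (k m : ℕ) → List (Vec ℕ k)
tuples zero    m = [] ∷ []
tuples (suc k) m = concatMap (λ p → map (p ∷_) (tuples k m)) (upTo (suc m))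

-- a_k(m): number of P-positions with k piles, each pile ≤ m
a : ℕ → ℕ → ℕ
a k m = length (filter (λ v → nimSum v ≟ 0) (tuples k m))

-- A_k(n): number of P-positions with k piles, total number of counters ≤ 2n
-- (every pile is then ≤ 2n, so enumerating tuples k (2n) is exhaustive)
A : ℕ → ℕ → ℕ
A k n = length (filter (λ v → (nimSum v ≟ 0) ×-dec (total v ≤? 2 * n)) (tuples k (2 * n)))

-- In a P-position every pile equals the nim-sum of the others, which is at most their ordinary
-- sum; so each pile is at most half the total, and a P-position with at most 2n counters has
-- all piles ≤ n.  Conversely a position with all piles ≤ ⌊2n/k⌋ has at most 2n counters.
-- Both inequalities are then instances of one monotonicity principle for counting filtered
-- tuples.
module Submission where

open import Defs
open import Data.Bool using (true; false; _xor_; if_then_else_)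
open import Data.Bool.Properties using (xor-comm)
open import Data.Empty using (⊥-elim)
open import Data.List using (List; []; _∷_; _++_; concatMap; filter; length; map; upTo)
open import Data.List.Properties using (filter-++; filter-none; length-++; map-++; map-cong; upTo-∷ʳ)
import Data.List.Relation.Unary.All as ListAll
open import Data.Nat using (ℕ; zero; suc; _+_; _*_; _/_; _%_; _≤_; _<_; _≟_; _≤?_; _≤′_; ≤′-refl; ≤′-step; z≤n; s≤s; s≤s⁻¹; NonZero)
open import Data.Nat.ListAction using (sum)
open import Data.Nat.ListAction.Properties using (sum-++)
open import Data.Nat.DivMod using (m≡m%n+[m/n]*n; m%n<n; m/n<m; m/n≤m; m/n*n≤m)
open import Data.Nat.Properties
open import Data.Nat.Tactic.RingSolver using (solve-∀)
open import Data.Product using (_×_; _,_; proj₁)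
open import Data.Vec using (Vec; []; _∷_)
open import Data.Vec.Relation.Unary.All as All using (All; []; _∷_)
open import Function using (_∘′_)
open import Level using (Level)
open import Relation.Binary.PropositionalEquality
open import Relation.Nullary using (¬_; yes; no; does)
open import Relation.Nullary.Decidable using (_×-dec_)
open import Relation.Unary using (Pred; Decidable)

private
  variable
    ℓ : Level


-- xorFuel (suc f) a b unfolds definitionally to xorDigit (a % 2) (b % 2) + 2 * xorFuel f (a / 2) (b / 2).
xorDigit : ℕ → ℕ → ℕ
xorDigit r s = if does (r ≟ 1) xor does (s ≟ 1) then 1 else 0

xorDigit-comm : ∀ r s → xorDigit r s ≡ xorDigit s r
xorDigit-comm r s = cong (if_then 1 else 0) (xor-comm (does (r ≟ 1)) (does (s ≟ 1)))

xorDigit≤+ : ∀ {r s} → r < 2 → s < 2 → xorDigit r s ≤ r + s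
xorDigit≤+ {0} {0} _ _ = z≤n
xorDigit≤+ {0} {1} _ _ = ≤-refl
xorDigit≤+ {1} {0} _ _ = ≤-refl
xorDigit≤+ {1} {1} _ _ = z≤n
xorDigit≤+ {suc (suc _)} (s≤s (s≤s ())) _
xorDigit≤+ {_} {suc (suc _)} _ (s≤s (s≤s ()))

≤xorDigit+ : ∀ {r s} → r < 2 → s < 2 → r ≤ xorDigit r s + s
≤xorDigit+ {0} {_} _ _ = z≤n
≤xorDigit+ {1} {0} _ _ = ≤-refl
≤xorDigit+ {1} {1} _ _ = ≤-refl
≤xorDigit+ {suc (suc _)} (s≤s (s≤s ())) _
≤xorDigit+ {1} {suc (suc _)} _ (s≤s (s≤s ()))

m≡m%2+2*[m/2] : ∀ m → m ≡ m % 2 + 2 * (m / 2)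
m≡m%2+2*[m/2] m = trans (m≡m%n+[m/n]*n m 2) (cong (m % 2 +_) (*-comm (m / 2) 2))

m≤1+n⇒m/2≤n : ∀ {m n} → m ≤ suc n → m / 2 ≤ n
m≤1+n⇒m/2≤n {zero}  _   = z≤n
m≤1+n⇒m/2≤n {suc m} m≤n = s≤s⁻¹ (≤-trans (m/n<m (suc m) 2 (s≤s (s≤s z≤n))) m≤n)

xorFuel-comm : ∀ f a b → xorFuel f a b ≡ xorFuel f b a
xorFuel-comm zero    a b = refl
xorFuel-comm (suc f) a b =
  cong₂ (λ d x → d + 2 * x) (xorDigit-comm (a % 2) (b % 2)) (xorFuel-comm f (a / 2) (b / 2))

xorFuel≤+ : ∀ f a b → xorFuel f a b ≤ a + b
xorFuel≤+ zero    a b = z≤n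
xorFuel≤+ (suc f) a b = begin
  xorDigit (a % 2) (b % 2) + 2 * xorFuel f (a / 2) (b / 2)
    ≤⟨ +-mono-≤ (xorDigit≤+ (m%n<n a 2) (m%n<n b 2)) (*-monoʳ-≤ 2 (xorFuel≤+ f (a / 2) (b / 2))) ⟩
  (a % 2 + b % 2) + 2 * (a / 2 + b / 2)
    ≡⟨ regroup (a % 2) (b % 2) (a / 2) (b / 2) ⟩
  (a % 2 + 2 * (a / 2)) + (b % 2 + 2 * (b / 2))
    ≡⟨ cong₂ _+_ (m≡m%2+2*[m/2] a) (m≡m%2+2*[m/2] b) ⟨
  a + b ∎
  where
  open ≤-Reasoning
  regroup : ∀ r s x y → (r + s) + 2 * (x + y) ≡ (r + 2 * x) + (s + 2 * y)
  regroup = solve-∀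

-- The fuel bound a ≤ f guarantees that the halvings of a are all consumed.
≤xorFuel+ : ∀ f a b → a ≤ f → a ≤ xorFuel f a b + b
≤xorFuel+ zero    zero    b _ = z≤n
≤xorFuel+ (suc f) a       b a≤f = begin
  a ≡⟨ m≡m%2+2*[m/2] a ⟩
  a % 2 + 2 * (a / 2)
    ≤⟨ +-mono-≤ (≤xorDigit+ (m%n<n a 2) (m%n<n b 2))
                (*-monoʳ-≤ 2 (≤xorFuel+ f (a / 2) (b / 2) (m≤1+n⇒m/2≤n a≤f))) ⟩
  (d + b % 2) + 2 * (xorFuel f (a / 2) (b / 2) + b / 2)
    ≡⟨ regroup d (b % 2) (xorFuel f (a / 2) (b / 2)) (b / 2) ⟩
  (d + 2 * xorFuel f (a / 2) (b / 2)) + (b % 2 + 2 * (b / 2))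
    ≡⟨ cong (d + 2 * xorFuel f (a / 2) (b / 2) +_) (m≡m%2+2*[m/2] b) ⟨
  xorFuel (suc f) a b + b ∎
  where
  open ≤-Reasoning
  d = xorDigit (a % 2) (b % 2)
  regroup : ∀ t r x y → (t + r) + 2 * (x + y) ≡ (t + 2 * x) + (r + 2 * y)
  regroup = solve-∀

⊕-comm : ∀ a b → a ⊕ b ≡ b ⊕ a
⊕-comm a b = trans (xorFuel-comm (a + b) a b) (cong (λ f → xorFuel f b a) (+-comm a b))

⊕≤+ : ∀ a b → a ⊕ b ≤ a + b
⊕≤+ a b = xorFuel≤+ (a + b) a b

≤⊕+ˡ : ∀ a b → a ≤ a ⊕ b + b
≤⊕+ˡ a b = ≤xorFuel+ (a + b) a b (m≤m+n a b)

≤⊕+ʳ : ∀ a b → b ≤ a ⊕ b + a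
≤⊕+ʳ a b = subst (λ x → b ≤ x + a) (⊕-comm b a) (≤⊕+ˡ b a)

nimSum≤total : ∀ {k} (v : Vec ℕ k) → nimSum v ≤ total v
nimSum≤total []      = z≤n
nimSum≤total (p ∷ v) = ≤-trans (⊕≤+ p (nimSum v)) (+-monoʳ-≤ p (nimSum≤total v))

-- The form of the P-position bound 2e ≤ total that survives induction on the number of piles.
2*pile≤nimSum+total : ∀ {k} (v : Vec ℕ k) → All (λ e → 2 * e ≤ nimSum v + total v) v
2*pile≤nimSum+total []      = []
2*pile≤nimSum+total (p ∷ v) = head-bound ∷ All.map (λ {e} → tail-bound {e}) (2*pile≤nimSum+total v)
  where
  open ≤-Reasoning
  s = nimSum v
  t = total v
  x = p ⊕ s
  head-bound : 2 * p ≤ x + (p + t)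
  head-bound = begin
    p + (p + 0) ≡⟨ cong (p +_) (+-identityʳ p) ⟩
    p + p       ≤⟨ +-monoʳ-≤ p (≤-trans (≤⊕+ˡ p s) (+-monoʳ-≤ x (nimSum≤total v))) ⟩
    p + (x + t) ≡⟨ +-comm p (x + t) ⟩
    (x + t) + p ≡⟨ +-assoc x t p ⟩
    x + (t + p) ≡⟨ cong (x +_) (+-comm t p) ⟩
    x + (p + t) ∎
  tail-bound : ∀ {e} → 2 * e ≤ s + t → 2 * e ≤ x + (p + t)
  tail-bound {e} 2e≤s+t = begin
    2 * e       ≤⟨ 2e≤s+t ⟩
    s + t       ≤⟨ +-monoˡ-≤ t (≤⊕+ʳ p s) ⟩
    x + p + t   ≡⟨ +-assoc x p t ⟩
    x + (p + t) ∎

P-position-piles≤ : ∀ {k} n (v : Vec ℕ k) → nimSum v ≡ 0 → total v ≤ 2 * n → All (_≤ n) v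
P-position-piles≤ n v nim≡0 t≤2n = All.map (λ {e} 2e≤ → *-cancelˡ-≤ {e} 2 (≤-trans 2e≤ t≤2n))
  (subst (λ s → All (λ e → 2 * e ≤ s + total v) v) nim≡0 (2*pile≤nimSum+total v))

total≤k*m : ∀ {k} m {v : Vec ℕ k} → All (_≤ m) v → total v ≤ k * m
total≤k*m m []         = z≤n
total≤k*m m (p≤m ∷ ps) = +-mono-≤ p≤m (total≤k*m m ps)


sumBelow : (ℕ → ℕ) → ℕ → ℕ
sumBelow f zero    = 0
sumBelow f (suc n) = sumBelow f n + f n

sum-map-upTo : ∀ f n → sum (map f (upTo n)) ≡ sumBelow f n
sum-map-upTo f zero    = refl
sum-map-upTo f (suc n) = begin
  sum (map f (upTo (suc n)))          ≡⟨ cong (sum ∘′ map f) (upTo-∷ʳ n) ⟨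
  sum (map f (upTo n ++ n ∷ []))      ≡⟨ cong sum (map-++ f (upTo n) (n ∷ [])) ⟩
  sum (map f (upTo n) ++ f n ∷ [])    ≡⟨ sum-++ (map f (upTo n)) (f n ∷ []) ⟩
  sum (map f (upTo n)) + (f n + 0)    ≡⟨ cong₂ _+_ (sum-map-upTo f n) (+-identityʳ (f n)) ⟩
  sumBelow f n + f n                  ∎
  where open ≡-Reasoning

sumBelow-cong : ∀ {f g} → (∀ p → f p ≡ g p) → ∀ n → sumBelow f n ≡ sumBelow g n
sumBelow-cong f≗g zero    = refl
sumBelow-cong f≗g (suc n) = cong₂ _+_ (sumBelow-cong f≗g n) (f≗g n)

sumBelow-mono-≤ : ∀ {f g} n → (∀ p → p < n → f p ≤ g p) → sumBelow f n ≤ sumBelow g n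
sumBelow-mono-≤ zero    _   = z≤n
sumBelow-mono-≤ (suc n) f≤g =
  +-mono-≤ (sumBelow-mono-≤ n (λ p p<n → f≤g p (m<n⇒m<1+n p<n))) (f≤g n ≤-refl)

sumBelow-monoʳ-≤ : ∀ f {m n} → m ≤′ n → sumBelow f m ≤ sumBelow f n
sumBelow-monoʳ-≤ f ≤′-refl        = ≤-refl
sumBelow-monoʳ-≤ f (≤′-step m≤′n) = ≤-trans (sumBelow-monoʳ-≤ f m≤′n) (m≤m+n _ _)

sumBelow-vanishing : ∀ {f} {m n} → m ≤′ n → (∀ p → m ≤ p → f p ≡ 0) → sumBelow f n ≡ sumBelow f m
sumBelow-vanishing ≤′-refl                   _ = refl
sumBelow-vanishing {f} {m} (≤′-step {n} m≤′n) f≡0 = begin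
  sumBelow f n + f n ≡⟨ cong₂ _+_ (sumBelow-vanishing m≤′n f≡0) (f≡0 n (≤′⇒≤ m≤′n)) ⟩
  sumBelow f m + 0   ≡⟨ +-identityʳ _ ⟩
  sumBelow f m       ∎
  where open ≡-Reasoning


module _ {A B : Set} {P : Pred B ℓ} (P? : Decidable P) where

  length-filter-concatMap : ∀ (f : A → List B) xs →
    length (filter P? (concatMap f xs)) ≡ sum (map (λ x → length (filter P? (f x))) xs)
  length-filter-concatMap f []       = refl
  length-filter-concatMap f (x ∷ xs) = begin
    length (filter P? (f x ++ concatMap f xs))                ≡⟨ cong length (filter-++ P? (f x) (concatMap f xs)) ⟩
    length (filter P? (f x) ++ filter P? (concatMap f xs))    ≡⟨ length-++ (filter P? (f x)) ⟩
    length (filter P? (f x)) + length (filter P? (concatMap f xs))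
      ≡⟨ cong (length (filter P? (f x)) +_) (length-filter-concatMap f xs) ⟩
    length (filter P? (f x)) + sum (map (λ x → length (filter P? (f x))) xs) ∎
    where open ≡-Reasoning

  length-filter-map : ∀ (g : A → B) xs →
    length (filter P? (map g xs)) ≡ length (filter (λ x → P? (g x)) xs)
  length-filter-map g []       = refl
  length-filter-map g (x ∷ xs) with does (P? (g x))
  ... | true  = cong suc (length-filter-map g xs)
  ... | false = length-filter-map g xs

count : ∀ {k} {P : Pred (Vec ℕ k) ℓ} → Decidable P → ℕ → ℕ
count {k = k} P? m = length (filter P? (tuples k m))

count-suc : ∀ {k} {P : Pred (Vec ℕ (suc k)) ℓ} (P? : Decidable P) m →
  count P? m ≡ sumBelow (λ p → count (λ v → P? (p ∷ v)) m) (suc m)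
count-suc {k = k} P? m = begin
  length (filter P? (concatMap (λ p → map (p ∷_) (tuples k m)) (upTo (suc m))))
    ≡⟨ length-filter-concatMap P? (λ p → map (p ∷_) (tuples k m)) (upTo (suc m)) ⟩
  sum (map (λ p → length (filter P? (map (p ∷_) (tuples k m)))) (upTo (suc m)))
    ≡⟨ cong sum (map-cong (λ p → length-filter-map P? (p ∷_) (tuples k m)) (upTo (suc m))) ⟩
  sum (map (λ p → count (λ v → P? (p ∷ v)) m) (upTo (suc m)))
    ≡⟨ sum-map-upTo _ (suc m) ⟩
  sumBelow (λ p → count (λ v → P? (p ∷ v)) m) (suc m) ∎
  where open ≡-Reasoning

count-none : ∀ {k} {P : Pred (Vec ℕ k) ℓ} (P? : Decidable P) m → (∀ v → ¬ P v) → count P? m ≡ 0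
count-none {k = k} P? m ¬P = cong length (filter-none P? (ListAll.universal ¬P (tuples k m)))

count-mono : ∀ {k} {P Q : Pred (Vec ℕ k) ℓ} (P? : Decidable P) (Q? : Decidable Q) {m m'} → m ≤ m' →
  (∀ v → All (_≤ m) v → P v → Q v) → count P? m ≤ count Q? m'
count-mono {k = zero} P? Q? _ P⇒Q with P? [] | Q? []
... | yes _  | yes _  = ≤-refl
... | yes Pε | no ¬Qε = ⊥-elim (¬Qε (P⇒Q [] [] Pε))
... | no _   | _      = z≤n
count-mono {k = suc k} P? Q? {m} {m'} m≤m' P⇒Q = begin
  count P? m                                                 ≡⟨ count-suc P? m ⟩
  sumBelow (λ p → count (λ v → P? (p ∷ v)) m) (suc m)
    ≤⟨ sumBelow-mono-≤ (suc m) (λ p p<1+m → count-mono (λ v → P? (p ∷ v)) (λ v → Q? (p ∷ v)) m≤m'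
                                   (λ v v≤m → P⇒Q (p ∷ v) (s≤s⁻¹ p<1+m ∷ v≤m))) ⟩
  sumBelow (λ p → count (λ v → Q? (p ∷ v)) m') (suc m)
    ≤⟨ sumBelow-monoʳ-≤ _ (≤⇒≤′ (s≤s m≤m')) ⟩
  sumBelow (λ p → count (λ v → Q? (p ∷ v)) m') (suc m')     ≡⟨ count-suc Q? m' ⟨
  count Q? m' ∎
  where open ≤-Reasoning

count-restrict : ∀ {k} {P : Pred (Vec ℕ k) ℓ} (P? : Decidable P) {m m'} → m ≤ m' →
  (∀ v → P v → All (_≤ m) v) → count P? m' ≡ count P? m
count-restrict {k = zero}  P? _ _ = refl
count-restrict {k = suc k} P? {m} {m'} m≤m' P⇒≤m = begin
  count P? m'                                                ≡⟨ count-suc P? m' ⟩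
  sumBelow (λ p → count (λ v → P? (p ∷ v)) m') (suc m')
    ≡⟨ sumBelow-vanishing (≤⇒≤′ (s≤s m≤m')) (λ p m<p → count-none _ m'
         (λ v P[p∷v] → <⇒≱ m<p (All.head (P⇒≤m (p ∷ v) P[p∷v])))) ⟩
  sumBelow (λ p → count (λ v → P? (p ∷ v)) m') (suc m)
    ≡⟨ sumBelow-cong (λ p → count-restrict (λ v → P? (p ∷ v)) m≤m'
         (λ v P[p∷v] → All.tail (P⇒≤m (p ∷ v) P[p∷v]))) (suc m) ⟩
  sumBelow (λ p → count (λ v → P? (p ∷ v)) m) (suc m)       ≡⟨ count-suc P? m ⟨
  count P? m ∎
  where open ≡-Reasoning

corollary7 : (k n : ℕ) → .{{_ : NonZero k}} → a k ((2 * n) / k) ≤ A k n × A k n ≤ a k n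
corollary7 k n = lower , upper
  where
  P-position? = λ (v : Vec ℕ k) → nimSum v ≟ 0
  bounded-P-position? = λ (v : Vec ℕ k) → (nimSum v ≟ 0) ×-dec (total v ≤? 2 * n)
  m = (2 * n) / k

  lower : a k m ≤ A k n
  lower = count-mono P-position? bounded-P-position? (m/n≤m (2 * n) k) λ v v≤m nim≡0 →
    nim≡0 , ≤-trans (total≤k*m m v≤m) (≤-trans (≤-reflexive (*-comm k m)) (m/n*n≤m (2 * n) k))

  upper : A k n ≤ a k n
  upper = begin
    count bounded-P-position? (2 * n) ≡⟨ count-restrict bounded-P-position? (m≤m+n n _)
                                            (λ v (nim≡0 , t≤2n) → P-position-piles≤ n v nim≡0 t≤2n) ⟩
    count bounded-P-position? n       ≤⟨ count-mono bounded-P-position? P-position? ≤-refl (λ _ _ → proj₁) ⟩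
    count P-position? n               ∎
    where open ≤-Reasoning
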